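{- Let $\mathcal{H}$ be a pseudohalfplane hypergraph on $V$ with witnessing ABA-free hypergraph $\mathcal{F}$ (so $\mathcal{H}\subseteq\mathcal{F}\cup\bar{\mathcal{F}}$). Then every nonempty hyperedge of $\mathcal{H}$ contains an extremal vertex.
   Context: Let $V$ be a finite totally ordered set. A hypergraph $\mathcal{F}$ on $V$ is ABA-free if there are no two hyperedges $A,B\in\mathcal{F}$ and vertices $x<y<z$ with $x,z\in A\setminus B$ and $y\in B\setminus A$. Let $\bar{\mathcal{F}}=\{V\setminus F: F\in\mathcal{F}\}$. $\mathcal{H}$ is a pseudohalfplane hypergraph if $\mathcal{H}\subseteq\mathcal{F}\cup\bar{\mathcal{F}}$ for some ABA-free $\mathcal{F}$ on $V$; fix such an $\mathcal{F}$. A vertex $a$ is skippable in a hypergraph $\mathcal{G}$ on $V$ if some $A\in\mathcal{G}$ has $\min(A)<a<\max(A)$ and $a\notin A$, and unskippable otherwise. The topvertices are the unskippable vertices of $\mathcal{F}$, the bottomvertices are the unskippable vertices of $\bar{\mathcal{F}}$, and the extremal vertices of $\mathcal{H}$ (with respect to $\mathcal{F}$) are the vertices that are topvertices or bottomvertices. -}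

module Defs where

open import Data.Nat using (ℕ)
open import Data.Fin using (Fin; _<_)
open import Data.Fin.Subset using (Subset; _∈_; _∉_; ∁)
open import Data.List using (List; map)
import Data.List.Membership.Propositional as L
open import Data.Product using (∃; _×_; _,_)
open import Data.Sum using (_⊎_)
open import Relation.Nullary using (¬_)

-- The vertex set V is Fin n with its natural total order.
-- A hypergraph on V is a finite list of hyperedges (subsets of V).
Hypergraph : ℕ → Set
Hypergraph n = List (Subset n)

ABA-free : ∀ {n} → Hypergraph n → Set
ABA-free {n} F =
  ∀ (A B : Subset n) → A L.∈ F → B L.∈ F →
  ∀ (x y z : Fin n) → x < y → y < z →
  ¬ ((x ∈ A × x ∉ B) × (z ∈ A × z ∉ B) × (y ∈ B × y ∉ A))

complementHG : ∀ {n} → Hypergraph n → Hypergraph n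
complementHG F = map ∁ F

_⊆HG_∪_ : ∀ {n} → Hypergraph n → Hypergraph n → Hypergraph n → Set
H ⊆HG F ∪ G = ∀ E → E L.∈ H → E L.∈ F ⊎ E L.∈ G

-- a is skippable in G: some A ∈ G with min(A) < a < max(A) and a ∉ A.
-- (min(A) < a < max(A) unfolds to: some x, z ∈ A with x < a < z.)
Skippable : ∀ {n} → Hypergraph n → Fin n → Set
Skippable {n} G a =
  ∃ λ (A : Subset n) → A L.∈ G × a ∉ A ×
    (∃ λ (x : Fin n) → x ∈ A × x < a) × (∃ λ (z : Fin n) → z ∈ A × a < z)

Unskippable : ∀ {n} → Hypergraph n → Fin n → Set
Unskippable G a = ¬ Skippable G a

TopVertex : ∀ {n} → Hypergraph n → Fin n → Set
TopVertex F a = Unskippable F a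

BottomVertex : ∀ {n} → Hypergraph n → Fin n → Set
BottomVertex F a = Unskippable (complementHG F) a

Extremal : ∀ {n} → Hypergraph n → Fin n → Set
Extremal F a = TopVertex F a ⊎ BottomVertex F a

{-# OPTIONS --safe #-}
module Submission where

open import Defs
open import Data.Nat using (ℕ; z≤n; s≤s)
open import Data.Fin using (Fin; zero; suc; _<_; _>_)
open import Data.Fin.Properties using (any?; _<?_; <-cmp; <-trans)
open import Data.Fin.Induction using (<-wellFounded; >-wellFounded)
open import Data.Fin.Subset using (Subset; _∈_; _∉_; ∁)
open import Data.Fin.Subset.Properties using (_∈?_; x∈∁p⇒x∉p; x∉∁p⇒x∈p)
open import Data.List.Relation.Unary.Any as Any using ()
open import Data.List.Membership.Propositional using (find; lose) renaming (_∈_ to _∈L_)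
open import Data.List.Membership.Propositional.Properties using (∈-map⁻)
open import Data.Product using (∃; _×_; _,_)
open import Data.Sum using (_⊎_; inj₁; inj₂)
open import Data.Empty using (⊥; ⊥-elim)
open import Data.Unit using (tt)
open import Relation.Nullary using (¬_; Dec; yes; no)
open import Relation.Nullary.Decidable using (_×-dec_; ¬?; map′)
open import Relation.Unary using (Pred; Decidable)
open import Relation.Binary using (tri<; tri≈; tri>)
open import Relation.Binary.PropositionalEquality using (refl)
open import Induction.WellFounded using (Acc; acc)

-- The complement of an ABA-free hypergraph is ABA-free, so it suffices that every nonempty
-- hyperedge E of an ABA-free G contains an unskippable vertex of G.  Walk rightwards from the
-- unskippable vertex 0, keeping an unskippable t and a point z > t such that every hyperedge
-- meeting the open interval (t, z) contains t or z.  A skippable z is pushed to the next vertex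
-- of a hyperedge B skipping it, and ABA-freeness against B preserves the invariant; an
-- unskippable z becomes the new t.  Once z passes a vertex u ∈ E, the invariant puts t or z
-- into E.

skippable? : ∀ {n} (G : Hypergraph n) (a : Fin n) → Dec (Skippable G a)
skippable? G a = map′ find (λ (A , A∈G , sk) → lose A∈G sk) (Any.any? skips? G)
  where
  skips? : ∀ A → Dec (a ∉ A × (∃ λ x → x ∈ A × x < a) × (∃ λ z → z ∈ A × a < z))
  skips? A = ¬? (a ∈? A) ×-dec any? (λ x → x ∈? A ×-dec x <? a)
                         ×-dec any? (λ z → z ∈? A ×-dec a <? z)

zero-unskippable : ∀ {m} (G : Hypergraph (ℕ.suc m)) → Unskippable G zero
zero-unskippable G (_ , _ , _ , (_ , _ , ()) , _)

zero<suc : ∀ {m} (u : Fin m) → zero {m} < suc u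
zero<suc u = s≤s z≤n

nearest-above : ∀ {n p} {P : Pred (Fin n) p} → Decidable P → ∀ (z w : Fin n) → Acc _<_ w → z < w → P w →
  ∃ λ w′ → z < w′ × P w′ × (∀ v → z < v → v < w′ → ¬ P v)
nearest-above P? z w (acc rs) z<w Pw with any? (λ v → z <? v ×-dec v <? w ×-dec P? v)
... | yes (v , z<v , v<w , Pv) = nearest-above P? z v (rs v<w) z<v Pv
... | no none = w , z<w , Pw , λ v z<v v<w Pv → none (v , z<v , v<w , Pv)

Adjacent : ∀ {n} → Fin n → Fin n → Set
Adjacent {n} t z = ∀ (v : Fin n) → t < v → v < z → ⊥

adjacent-above : ∀ {n} {z u : Fin n} → z < u → ∃ λ z′ → z < z′ × Adjacent z z′
adjacent-above {z = z} {u} z<u =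
  let z′ , z<z′ , _ , nothing-between = nearest-above (λ _ → yes tt) z u (<-wellFounded u) z<u tt
  in z′ , z<z′ , λ v z<v v<z′ → nothing-between v z<v v<z′ tt

ABA-free-complement : ∀ {n} {F : Hypergraph n} → ABA-free F → ABA-free (complementHG F)
ABA-free-complement aba A′ B′ A′∈ B′∈ x y z x<y y<z ((x∈A′ , x∉B′) , (z∈A′ , z∉B′) , (y∈B′ , y∉A′))
  with ∈-map⁻ ∁ A′∈ | ∈-map⁻ ∁ B′∈
... | A , A∈ , refl | B , B∈ , refl =
  aba B A B∈ A∈ x y z x<y y<z
    ( (x∉∁p⇒x∈p x∉B′ , x∈∁p⇒x∉p x∈A′)
    , (x∉∁p⇒x∈p z∉B′ , x∈∁p⇒x∉p z∈A′)
    , (x∉∁p⇒x∈p y∉A′ , x∈∁p⇒x∉p y∈B′))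

module _ {n : ℕ} (G : Hypergraph n) (aba : ABA-free G) where

  Guarded : Fin n → Fin n → Set
  Guarded t z = ∀ D → D ∈L G → ∀ u → t < u → u < z → u ∈ D → t ∈ D ⊎ z ∈ D

  adjacent⇒guarded : ∀ {t z} → Adjacent t z → Guarded t z
  adjacent⇒guarded adj D _ u t<u u<z _ = ⊥-elim (adj u t<u u<z)

  -- A hyperedge D meeting (t, w) but missing t and w must contain z, and then B, D form the
  -- pattern t < z < w; t ∈ B because B would otherwise skip t or break the invariant at x.
  guarded-extend : ∀ {t z w B} → B ∈L G → Unskippable G t → Guarded t z → t < z →
    z ∉ B → (∃ λ x → x ∈ B × x < z) → w ∈ B → z < w → (∀ v → z < v → v < w → v ∉ B) →
    Guarded t w
  guarded-extend {t} {z} {w} {B} B∈G t-unsk guard t<z z∉B (x , x∈B , x<z) w∈B z<w gap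
    D D∈G u t<u u<w u∈D with t ∈? D | w ∈? D
  ... | yes t∈D | _ = inj₁ t∈D
  ... | no _ | yes w∈D = inj₂ w∈D
  ... | no t∉D | no w∉D = ⊥-elim (aba B D B∈G D∈G t z w t<z z<w ((t∈B , t∉D) , (w∈B , w∉D) , (z∈D , z∉B)))
    where
    t∈B : t ∈ B
    t∈B with <-cmp x t
    ... | tri≈ _ refl _ = x∈B
    ... | tri< x<t _ _ with t ∈? B
    ...   | yes t∈B = t∈B
    ...   | no t∉B = ⊥-elim (t-unsk (B , B∈G , t∉B , (x , x∈B , x<t) , (w , w∈B , <-trans t<z z<w)))
    t∈B | tri> _ _ t<x with guard B B∈G x t<x x<z x∈B
    ...   | inj₁ t∈B = t∈B
    ...   | inj₂ z∈B = ⊥-elim (z∉B z∈B)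
    z∈D : z ∈ D
    z∈D with <-cmp u z
    ... | tri≈ _ refl _ = u∈D
    ... | tri< u<z _ _ with guard D D∈G u t<u u<z u∈D
    ...   | inj₁ t∈D = ⊥-elim (t∉D t∈D)
    ...   | inj₂ z∈D = z∈D
    z∈D | tri> _ _ z<u =
      ⊥-elim (aba B D B∈G D∈G t u w t<u u<w ((t∈B , t∉D) , (w∈B , w∉D) , (u∈D , gap u z<u u<w)))

  find-unskippable : ∀ {E u} → E ∈L G → u ∈ E → ∀ t z → Acc _>_ z → Unskippable G t → t < u → t < z →
    Guarded t z → ∃ λ v → v ∈ E × Unskippable G v
  find-unskippable {E} {u} E∈G u∈E t z (acc rs) t-unsk t<u t<z guard with skippable? G z
  ... | yes (B , B∈G , z∉B , below , (w , w∈B , z<w)) =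
    let w′ , z<w′ , w′∈B , gap = nearest-above (_∈? B) z w (<-wellFounded w) z<w w∈B
    in find-unskippable E∈G u∈E t w′ (rs z<w′) t-unsk t<u (<-trans t<z z<w′)
         (guarded-extend B∈G t-unsk guard t<z z∉B below w′∈B z<w′ gap)
  ... | no z-unsk with <-cmp z u
  ...   | tri≈ _ refl _ = z , u∈E , z-unsk
  ...   | tri> _ _ u<z with guard E E∈G u t<u u<z u∈E
  ...     | inj₁ t∈E = t , t∈E , t-unsk
  ...     | inj₂ z∈E = z , z∈E , z-unsk
  find-unskippable E∈G u∈E t z (acc rs) _ _ _ _ | no z-unsk | tri< z<u _ _ =
    let z′ , z<z′ , adj = adjacent-above z<u
    in find-unskippable E∈G u∈E z z′ (rs z<z′) z-unsk z<u z<z′ (adjacent⇒guarded adj)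

  edge-contains-unskippable : ∀ {E} → E ∈L G → (∃ λ v → v ∈ E) → ∃ λ v → v ∈ E × Unskippable G v
  edge-contains-unskippable E∈G (zero , 0∈E) = zero , 0∈E , zero-unskippable G
  edge-contains-unskippable E∈G (suc u , u∈E) =
    let z , 0<z , adj = adjacent-above (zero<suc u)
    in find-unskippable E∈G u∈E zero z (>-wellFounded z) (zero-unskippable G) (zero<suc u) 0<z (adjacent⇒guarded adj)

mainTheorem14 : ∀ {n : ℕ} (F H : Hypergraph n) → ABA-free F →
    H ⊆HG F ∪ complementHG F →
    ∀ (E : Subset n) → E ∈L H → (∃ λ (v : Fin n) → v ∈ E) →
    ∃ λ (v : Fin n) → v ∈ E × Extremal F v
mainTheorem14 F H aba H⊆F∪F̄ E E∈H nonempty with H⊆F∪F̄ E E∈H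
... | inj₁ E∈F =
  let v , v∈E , top = edge-contains-unskippable F aba E∈F nonempty in v , v∈E , inj₁ top
... | inj₂ E∈F̄ =
  let v , v∈E , bottom = edge-contains-unskippable (complementHG F) (ABA-free-complement aba) E∈F̄ nonempty
  in v , v∈E , inj₂ bottom
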